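{- Fix $\alpha\in(1/2,1)$ and let $B_n$ ($n\geq 0$) be the trees defined in the context. For every $n\geq 0$ and every rooted binary tree $T$ on $n$ nodes, $B_n$ contains a subgraph isomorphic to a subdivision of $T$ (i.e., $T$ is a topological minor of $B_n$).
   Context: Trees are finite and rooted, edges directed from parent to child; binary means every node has at most two children. A rooted tree $T$ is a topological minor of a rooted tree $U$ if $U$ contains as a subgraph, respecting root and edge directions, a subdivision of $T$; equivalently there is an injective map $f$ from nodes of $T$ to nodes of $U$ with $f(\mathsf{NCA}_T(u,v))=\mathsf{NCA}_U(f(u),f(v))$. Sequences $a_N$ of positive integers: $a_0$ is the empty sequence, $a_1=(1)$, and for $N\geq 2$, $a_N=a_{\lfloor N/2\rfloor}\oplus(N)\oplus a_{\lfloor N/2\rfloor}$, where $\oplus$ is concatenation. "Attaching a copy of a tree $X$ to a node $u$" means adding a disjoint copy of $X$ and making its root a child of $u$ (attaching the empty tree does nothing). Define $B_0$ as the empty tree and $B_1$ as a single node. For $n\geq 2$, let $a_{\lfloor(1-\alpha)n\rfloor}=(a(1),\dots,a(k))$; $B_n$ consists of a path $u_1-u_2-\dots-u_{k+1}$ rooted at $u_1$, where for each $i=1,\dots,k$ a copy of $B_{a(i)-1}$ is attached to $u_i$, and additionally a copy of $B_{\lfloor\alpha n\rfloor}$ and a copy of $B_{\lfloor (n-1)/2\rfloor}$ are attached to $u_{k+1}$. -}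

module Defs where

open import Data.Nat using (ℕ; zero; suc; _∸_; _/_)
open import Data.Integer using (+_)
open import Data.Rational using (ℚ; _<_; _*_; _-_; _+_; 1ℚ)
import Data.Rational as ℚ
open import Data.Fin using (Fin)
open import Data.List using (List; []; _∷_; _++_; [_]; length; lookup)
open import Data.Maybe using (Maybe; just; nothing)
open import Data.Product using (Σ; ∃; _×_; _,_)
open import Data.Sum using (_⊎_)
open import Data.Unit using (⊤)
open import Data.Empty using (⊥)
open import Relation.Nullary using (¬_)
open import Relation.Binary.PropositionalEquality using (_≢_)

-- Real numbers as (two-sided) Dedekind cuts:  Lo q  means  q < α,
-- Up q  means  α < q.

record ℝ : Set₁ where
  field
    Lo Up       : ℚ → Set
    Lo-inhabited : ∃ Lo
    Up-inhabited : ∃ Up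
    Lo-rounded₁ : ∀ q → Lo q → ∃ λ r → q < r × Lo r
    Lo-rounded₂ : ∀ q r → q < r → Lo r → Lo q
    Up-rounded₁ : ∀ q → Up q → ∃ λ r → r < q × Up r
    Up-rounded₂ : ∀ q r → r < q → Up r → Up q
    disjoint    : ∀ q → ¬ (Lo q × Up q)
    located     : ∀ q r → q < r → Lo q ⊎ Up r

open ℝ public

ι : ℕ → ℚ
ι n = + n ℚ./ 1

_<[_·_] : ℚ → ℝ → ℕ → Set
x <[ α · n ] = ∃ λ q → Lo α q × x < q * ι n

[_·_]<_ : ℝ → ℕ → ℚ → Set
[ α · n ]< x = ∃ λ q → Up α q × q * ι n < x

-- fl n = ⌊ α n ⌋ :   fl n ≤ α n < fl n + 1
IsFloorMul : ℝ → (ℕ → ℕ) → Set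
IsFloorMul α fl = ∀ n → ¬ ([ α · n ]< ι (fl n)) × [ α · n ]< ι (suc (fl n))

-- fc n = ⌊ (1-α) n ⌋ :  fc n ≤ n - α n < fc n + 1,
-- i.e.  ¬ (n - fc n < α n)  and  n - (fc n + 1) < α n
IsFloorOneMinusMul : ℝ → (ℕ → ℕ) → Set
IsFloorOneMinusMul α fc =
  ∀ n → ¬ ((ι n - ι (fc n)) <[ α · n ]) × (ι n - ι (suc (fc n))) <[ α · n ]

-- The sequences a_N  (a_0 = [], a_N = a_{⌊N/2⌋} ++ [N] ++ a_{⌊N/2⌋}),
-- computed with fuel (fuel N suffices, since ⌊N/2⌋ ≤ N - 1 for N ≥ 1).

aFuel : ℕ → ℕ → List ℕ
aFuel zero    _       = []
aFuel (suc f) zero    = []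
aFuel (suc f) (suc m) = aFuel f (suc m / 2) ++ [ suc m ] ++ aFuel f (suc m / 2)

aSeq : ℕ → List ℕ
aSeq N = aFuel N N

-- Finite rooted (unordered-children) trees; a possibly empty tree is
-- a  Maybe Tree  (nothing = the empty tree).

data Tree : Set where
  node : List Tree → Tree

opt : Maybe Tree → List Tree
opt nothing  = []
opt (just t) = t ∷ []

data _⊑_ (s : Tree) : Tree → Set where
  here  : s ⊑ s
  there : ∀ {ts} (i : Fin (length ts)) → s ⊑ lookup ts i → s ⊑ node ts

-- The trees B_n, parametrised by fl n = ⌊α n⌋ and fc n = ⌊(1-α) n⌋.
-- Computed with fuel: B n = BFuel (suc n) n; all recursive calls are on
-- arguments < n (given the floor specifications and α < 1).

module Construction (fl fc : ℕ → ℕ) where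

  BFuel : ℕ → ℕ → Maybe Tree
  -- path u_1 - ... - u_{k+1}; a copy of B_{a(i)-1} at u_i and copies of
  -- B_{⌊α n⌋}, B_{⌊(n-1)/2⌋} at u_{k+1}
  spine : ℕ → ℕ → List ℕ → Tree
  BFuel zero    _                   = nothing
  BFuel (suc f) zero                = nothing
  BFuel (suc f) (suc zero)          = just (node [])
  BFuel (suc f) n@(suc (suc m))     = just (spine f n (aSeq (fc n)))
  spine f n []       = node (opt (BFuel f (fl n)) ++ opt (BFuel f ((n ∸ 1) / 2)))
  spine f n (x ∷ xs) = node (opt (BFuel f (x ∸ 1)) ++ [ spine f n xs ])

  B : ℕ → Maybe Tree
  B n = BFuel (suc n) n

-- Rooted binary trees (each node has at most two children; the
-- left/right labelling is irrelevant for topological minors).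

data BTree : Set where
  nil : BTree
  bin : BTree → BTree → BTree

size : BTree → ℕ
size nil       = 0
size (bin l r) = suc (size l ℕ.+ size r)
  where import Data.Nat as ℕ

-- Emb T s : a subdivision of the nonempty tree T is a subgraph of the
-- tree s, with the root of T sent to the root of s (children of a node of
-- T are sent into the subtrees of pairwise distinct children).
Emb : BTree → Tree → Set
EmbBelow : BTree → Tree → Set
Emb nil _ = ⊤
Emb (bin nil nil) _ = ⊤
Emb (bin l@(bin _ _) nil) (node ts) =
  Σ (Fin (length ts)) λ i → EmbBelow l (lookup ts i)
Emb (bin nil r@(bin _ _)) (node ts) =
  Σ (Fin (length ts)) λ i → EmbBelow r (lookup ts i)
Emb (bin l@(bin _ _) r@(bin _ _)) (node ts) =
  Σ (Fin (length ts)) λ i → Σ (Fin (length ts)) λ j →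
    i ≢ j × EmbBelow l (lookup ts i) × EmbBelow r (lookup ts j)
EmbBelow T t = Σ Tree λ s → s ⊑ t × Emb T s

TopMinor : BTree → Maybe Tree → Set
TopMinor nil       _        = ⊤
TopMinor (bin l r) nothing  = ⊥
TopMinor (bin l r) (just u) = EmbBelow (bin l r) u

module Submission where

open import Defs
open import Data.Nat using (ℕ)
open import Data.Rational using (½; 1ℚ)
open import Relation.Binary.PropositionalEquality using (_≡_)
import Data.Nat as Nat

-- For n ≥ 2, with d = ⌊αn⌋, follow the heavy path of T
-- from the root, always entering the larger child, as long as that child
-- has more than d nodes.  The smaller children l₁, l₂, … met on the way
-- have total weight Σ (|lᵢ| + 1) ≤ |T| - d - 1 ≤ ⌊(1-α)n⌋, and a purely
-- combinatorial property of the sequences a_N (every list of demands of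
-- weight ≤ N is served, in order, by strictly larger entries of a_N) lets
-- us hang each lᵢ below the spine of B_n into some copy of B_{a(j)-1}.  At
-- the end of the heavy path the larger child has ≤ d nodes and the smaller
-- one ≤ ⌊(n-1)/2⌋, so both fit into the two trees attached to u_{k+1}.

module Rationals where

  open import Data.Nat as ℕ using (ℕ)
  open import Data.Nat.Divisibility using (∣1⇒≡1)
  open import Data.Integer as ℤ using (+_)
  import Data.Integer.Properties as ℤ
  open import Data.Rational using (mkℚ; _≤_; _<_; _+_; *≤*; *<*; NonNegative)
  open import Data.Rational.Properties using (normalize-coprime; normalize-nonNeg)
  open import Data.Product using (_,_)
  open import Relation.Binary.PropositionalEquality

  ι-normal : ∀ n → ι n ≡ mkℚ (+ n) 0 (λ (_ , d∣1) → ∣1⇒≡1 d∣1)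
  ι-normal n = normalize-coprime _

  ι-mono-≤ : ∀ {a b} → a ℕ.≤ b → ι a ≤ ι b
  ι-mono-≤ {a} {b} a≤b rewrite ι-normal a | ι-normal b =
    *≤* (subst₂ ℤ._≤_ (sym (ℤ.*-identityʳ (+ a))) (sym (ℤ.*-identityʳ (+ b))) (ℤ.+≤+ a≤b))

  ι-mono-< : ∀ {a b} → a ℕ.< b → ι a < ι b
  ι-mono-< {a} {b} a<b rewrite ι-normal a | ι-normal b =
    *<* (subst₂ ℤ._<_ (sym (ℤ.*-identityʳ (+ a))) (sym (ℤ.*-identityʳ (+ b))) (ℤ.+<+ a<b))

  ι-cancel-< : ∀ {a b} → ι a < ι b → a ℕ.< b
  ι-cancel-< {a} {b} lt rewrite ι-normal a | ι-normal b with lt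
  ... | *<* p = ℤ.drop‿+<+ (subst₂ ℤ._<_ (ℤ.*-identityʳ (+ a)) (ℤ.*-identityʳ (+ b)) p)

  ι-+ : ∀ a b → ι (a ℕ.+ b) ≡ ι a + ι b
  ι-+ a b rewrite ι-normal a | ι-normal b | ℤ.*-identityʳ (+ a) | ℤ.*-identityʳ (+ b) = refl

  ι-nonNeg : ∀ n → NonNegative (ι n)
  ι-nonNeg n = normalize-nonNeg n 1

-- The three properties of fl = ⌊α·⌋ and fc = ⌊(1-α)·⌋ the construction
-- relies on; only 0 < α < 1 matters here (we use ½ < α < 1).
module FloorFacts (α : ℝ) (½<α : Lo α ½) (α<1 : Up α 1ℚ) (fl fc : ℕ → ℕ)
                  (fl-spec : IsFloorMul α fl) (fc-spec : IsFloorOneMinusMul α fc) where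

  open import Data.Nat as ℕ using (ℕ; suc)
  import Data.Nat.Properties as ℕ
  open import Data.Rational
  open import Data.Rational.Properties
  open import Data.Product using (_,_; proj₁)
  open import Data.Empty using (⊥-elim)
  open import Relation.Nullary using (yes; no)
  open import Relation.Binary.Definitions using (tri<; tri≈; tri>)
  open import Relation.Binary.PropositionalEquality
  open Rationals

  lower<upper : ∀ {p q} → Lo α p → Up α q → p < q
  lower<upper {p} {q} p<α α<q with <-cmp p q
  ... | tri< p<q _ _ = p<q
  ... | tri≈ _ refl _ = ⊥-elim (disjoint α p (p<α , α<q))
  ... | tri> _ _ q<p = ⊥-elim (disjoint α q (Lo-rounded₂ α q p q<p p<α , α<q))

  -- ⌊αn⌋ < n for n ≥ 1, because α < r < 1 for some rational r.
  fl-< : ∀ n → 0 ℕ.< n → fl n ℕ.< n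
  fl-< n@(suc k) _ with fl n ℕ.<? n
  ... | yes fl<n = fl<n
  ... | no  fl≮n with Up-rounded₁ α 1ℚ α<1
  ...   | r , r<1 , α<r = ⊥-elim (proj₁ (fl-spec n) (r , α<r , rn<fl))
    where
    rn<fl : r * ι n < ι (fl n)
    rn<fl = <-≤-trans
              (subst (r * ι n <_) (*-identityˡ (ι n)) (*-monoˡ-<-pos (ι n) {{normalize-pos (suc k) 1}} r<1))
              (ι-mono-≤ (ℕ.≮⇒≥ fl≮n))

  -- ⌊(1-α)n⌋ ≤ n, because α n ≥ 0.
  fc-≤ : ∀ n → fc n ℕ.≤ n
  fc-≤ n with fc n ℕ.≤? n
  ... | yes fc≤n = fc≤n
  ... | no  fc≰n = ⊥-elim (proj₁ (fc-spec n) (½ , ½<α , n-fc<½n))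
    where
    n-fc<0 : ι n - ι (fc n) < 0ℚ
    n-fc<0 = subst (ι n - ι (fc n) <_) (+-inverseʳ (ι (fc n)))
               (+-monoˡ-< (- ι (fc n)) (ι-mono-< (ℕ.≰⇒> fc≰n)))
    n-fc<½n : ι n - ι (fc n) < ½ * ι n
    n-fc<½n = <-≤-trans n-fc<0 (*-monoˡ-≤-nonNeg ½ (nonNegative⁻¹ (ι n) {{ι-nonNeg n}}))

  -- ⌊αn⌋ + ⌊(1-α)n⌋ ≥ n - 1: from n - (fc n + 1) < α n < fl n + 1.
  floors-cover : ∀ n → n ℕ.≤ suc (fl n ℕ.+ fc n)
  floors-cover n with fl-spec n | fc-spec n
  ... | _ , q , α<q , qn<fl+1 | _ , p , p<α , n-fc-1<pn =
    subst (n ℕ.≤_) (ℕ.+-suc (fl n) (fc n)) (ℕ.≤-pred (ι-cancel-< n<fl+fc+2))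
    where
    pn≤qn : p * ι n ≤ q * ι n
    pn≤qn = *-monoʳ-≤-nonNeg (ι n) {{ι-nonNeg n}} (<⇒≤ (lower<upper p<α α<q))
    n-fc-1<fl+1 : ι n - ι (suc (fc n)) < ι (suc (fl n))
    n-fc-1<fl+1 = <-trans n-fc-1<pn (≤-<-trans pn≤qn qn<fl+1)
    cancel : ι n - ι (suc (fc n)) + ι (suc (fc n)) ≡ ι n
    cancel = trans (+-assoc (ι n) _ _)
               (trans (cong (λ z → ι n + z) (+-inverseˡ (ι (suc (fc n))))) (+-identityʳ (ι n)))
    n<fl+fc+2 : ι n < ι (suc (fl n) ℕ.+ suc (fc n))
    n<fl+fc+2 = subst₂ _<_ cancel (sym (ι-+ (suc (fl n)) (suc (fc n))))
                  (+-monoˡ-< (ι (suc (fc n))) n-fc-1<fl+1)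

module Sequences where

  open import Data.Nat
  open import Data.Nat.Properties
  open import Data.Nat.DivMod
  open import Data.Nat.ListAction using (sum)
  open import Data.Nat.ListAction.Properties using (sum-++)
  open import Data.List using (List; []; _∷_; _++_; map)
  open import Data.List.Properties using (map-++)
  open import Data.List.Relation.Unary.All using (All; _∷_)
  import Data.List.Relation.Unary.All as All
  import Data.List.Relation.Unary.All.Properties as All
  open import Data.List.Relation.Binary.Sublist.Heterogeneous using (Sublist; []; _∷_)
  open import Data.List.Relation.Binary.Sublist.Heterogeneous.Properties using (++⁺; ++ʳ)
  open import Relation.Binary.PropositionalEquality

  weight : List ℕ → ℕ
  weight cs = sum (map suc cs)

  weight-++ : ∀ ps qs → weight (ps ++ qs) ≡ weight ps + weight qs
  weight-++ ps qs = trans (cong sum (map-++ suc ps qs)) (sum-++ (map suc ps) (map suc qs))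

  data Cut (h : ℕ) : List ℕ → Set where
    fits     : ∀ {cs} → weight cs ≤ h → Cut h cs
    overflow : ∀ {ps c rs} → weight ps ≤ h → h < weight ps + suc c →
               Cut h (ps ++ c ∷ rs)

  cut : ∀ h cs → Cut h cs
  cut h [] = fits z≤n
  cut h (c ∷ cs) with compare h c
  cut h (.(suc (h + k)) ∷ cs) | less .h k = overflow {ps = []} z≤n (m≤n⇒m≤1+n (s≤s (m≤m+n h k)))
  cut h (.h ∷ cs)             | equal .h  = overflow {ps = []} z≤n ≤-refl
  cut .(suc (c + k)) (c ∷ cs) | greater .c k with cut k cs
  ... | fits w≤k = fits (+-monoʳ-≤ (suc c) w≤k)
  ... | overflow {ps} {c′} w≤k k<w+c′ = overflow {ps = c ∷ ps}
        (+-monoʳ-≤ (suc c) w≤k)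
        (subst (suc c + k <_) (sym (+-assoc (suc c) (weight ps) (suc c′))) (+-monoʳ-< (suc c) k<w+c′))

  -- If x exceeds h and x + y ≤ 2h + 1, then y ≤ h: after an overflowing
  -- prefix, the rest of the demands fit into the second copy of a_{⌊N/2⌋}.
  remainder-≤ : ∀ {h x y} → h < x → x + y ≤ suc (h + h) → y ≤ h
  remainder-≤ {h} {x} {y} h<x x+y≤ = +-cancelˡ-≤ h y h (≤-pred (≤-trans (+-monoˡ-≤ y h<x) x+y≤))

  ≤-double-half : ∀ N → N ≤ suc (N / 2 + N / 2)
  ≤-double-half N = begin
    N                       ≡⟨ m≡m%n+[m/n]*n N 2 ⟩
    N % 2 + (N / 2) * 2     ≤⟨ +-mono-≤ (≤-pred (m%n<n N 2)) (≤-reflexive (*-comm (N / 2) 2)) ⟩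
    1 + 2 * (N / 2)         ≡⟨ cong (λ z → suc (N / 2 + z)) (+-identityʳ (N / 2)) ⟩
    suc (N / 2 + N / 2)     ∎
    where open ≤-Reasoning

  half-< : ∀ m → suc m / 2 < suc m
  half-< m = m/n<m (suc m) 2 (s≤s (s≤s z≤n))

  -- Induction on N = a_h ++ [N] ++ a_h with h = ⌊N/2⌋, cutting cs at h.
  a-serves : ∀ f N → N ≤ f → ∀ {cs} → weight cs ≤ N → Sublist _<_ cs (aFuel f N)
  a-serves zero    zero    _ {[]} _ = []
  a-serves (suc f) zero    _ {[]} _ = []
  a-serves (suc f) (suc m) (s≤s m≤f) {cs} w≤N with cut (suc m / 2) cs
  ... | fits w≤h = ++ʳ _ (a-serves f (suc m / 2) (≤-trans (≤-pred (half-< m)) m≤f) w≤h)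
  ... | overflow {ps} {c} {rs} wps≤h h<wps+c =
    ++⁺ (a-serves f h h≤f wps≤h) (c<N ∷ a-serves f h h≤f wrs≤h)
    where
    h = suc m / 2
    h≤f = ≤-trans (≤-pred (half-< m)) m≤f
    split-weight : (weight ps + suc c) + weight rs ≤ suc m
    split-weight = subst (_≤ suc m)
      (trans (weight-++ ps (c ∷ rs)) (sym (+-assoc (weight ps) (suc c) (weight rs)))) w≤N
    c<N : c < suc m
    c<N = ≤-trans (m≤n+m (suc c) (weight ps)) (m+n≤o⇒m≤o _ split-weight)
    wrs≤h : weight rs ≤ h
    wrs≤h = remainder-≤ h<wps+c (≤-trans split-weight (≤-double-half (suc m)))

  -- All entries of a_N are at most N (so the trees B_{a(i)-1} are smaller
  -- than B_n and the induction hypothesis applies to them).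
  a-bounded : ∀ f N → All (_≤ N) (aFuel f N)
  a-bounded zero    N       = All.[]
  a-bounded (suc f) zero    = All.[]
  a-bounded (suc f) (suc m) = All.++⁺ half-bounded (≤-refl ∷ half-bounded)
    where
    half-bounded : All (_≤ suc m) (aFuel f (suc m / 2))
    half-bounded = All.map (λ x≤h → ≤-trans x≤h (<⇒≤ (half-< m))) (a-bounded f (suc m / 2))

module HeavyPaths where

  open import Data.Nat
  open import Data.Nat.Properties
  open import Data.List using (List; []; _∷_)
  open import Data.Product using (∃; _,_)
  open import Data.Empty using (⊥-elim)
  open import Relation.Nullary using (yes; no)
  open import Relation.Binary.PropositionalEquality
  open Sequences using (weight)

  data Children : BTree → BTree → BTree → Set where
    as-is   : ∀ {h l} → Children (bin h l) h l
    swapped : ∀ {h l} → Children (bin l h) h l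

  children-size : ∀ {T h l} → Children T h l → size T ≡ suc (size h + size l)
  children-size as-is             = refl
  children-size (swapped {h} {l}) = cong suc (+-comm (size l) (size h))

  flip : ∀ {T h l} → Children T h l → Children T l h
  flip as-is   = swapped
  flip swapped = as-is

  child-≤ : ∀ {T h l} → Children T h l → size h ≤ size T
  child-≤ {T} {h} {l} ch =
    subst (size h ≤_) (sym (children-size ch)) (m≤n⇒m≤1+n (m≤m+n (size h) (size l)))

  data HeavyPath (d : ℕ) : BTree → List ℕ → Set where
    stop : ∀ {T h l} → Children T h l → size l ≤ size h → size h ≤ d →
           HeavyPath d T []
    step : ∀ {T h l cs} → Children T h l → size l ≤ size h → d < size h →
           HeavyPath d h cs → HeavyPath d T (size l ∷ cs)

  mutual
    heavy-path : ∀ d l r → ∃ (HeavyPath d (bin l r))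
    heavy-path d l r with size r ≤? size l
    ... | yes r≤l = descend d l r as-is r≤l
    ... | no  r≰l = descend d r l swapped (<⇒≤ (≰⇒> r≰l))

    descend : ∀ d {T} h l → Children T h l → size l ≤ size h → ∃ (HeavyPath d T)
    descend d h l ch l≤h with size h ≤? d
    descend d h         l ch l≤h | yes h≤d = [] , stop ch l≤h h≤d
    descend d nil       l ch l≤h | no  h≰d = ⊥-elim (h≰d z≤n)
    descend d (bin a b) l ch l≤h | no  h≰d with heavy-path d a b
    ... | cs , path = size l ∷ cs , step ch l≤h (≰⇒> h≰d) path

  -- The recorded sizes have total weight at most |T| - (d + 1): the path
  -- leaves at least d + 1 nodes in the last heavy child.
  heavy-path-weight : ∀ {d T cs} → HeavyPath d T cs → weight cs ≤ size T ∸ suc d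
  heavy-path-weight (stop _ _ _) = z≤n
  heavy-path-weight {d} (step {T} {h} {l} {cs} ch _ d<h path) = begin
    suc (size l) + weight cs             ≤⟨ +-monoʳ-≤ (suc (size l)) (heavy-path-weight path) ⟩
    suc (size l) + (size h ∸ suc d)      ≡⟨ +-∸-assoc (suc (size l)) d<h ⟨
    (suc (size l) + size h) ∸ suc d      ≡⟨ cong (λ z → suc z ∸ suc d) (+-comm (size l) (size h)) ⟩
    suc (size h + size l) ∸ suc d        ≡⟨ cong (_∸ suc d) (children-size ch) ⟨
    size T ∸ suc d                       ∎
    where open ≤-Reasoning

module Universality (fl fc : ℕ → ℕ)
  (fl-< : ∀ n → 0 Nat.< n → fl n Nat.< n)
  (fc-≤ : ∀ n → fc n Nat.≤ n)
  (floors-cover : ∀ n → n Nat.≤ Nat.suc (fl n Nat.+ fc n)) where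

  open import Data.Nat
  open import Data.Nat.Properties
  open import Data.Nat.DivMod
  open import Data.Fin using (zero; suc)
  open import Data.Maybe using (Maybe; just; nothing)
  open import Data.List using ([]; _∷_; _++_; [_])
  open import Data.List.Relation.Unary.All using (All; _∷_)
  import Data.List.Relation.Unary.All as All
  open import Data.List.Relation.Binary.Sublist.Heterogeneous using (Sublist; _∷_; _∷ʳ_)
  open import Data.Product using (_,_)
  open import Data.Unit using (tt)
  open import Relation.Binary.PropositionalEquality hiding ([_])
  open Sequences
  open HeavyPaths
  open Construction fl fc

  swap-children : ∀ l r t → Emb (bin l r) t → Emb (bin r l) t
  swap-children nil       nil       t         e = tt
  swap-children nil       (bin _ _) (node ts) e = e
  swap-children (bin _ _) nil       (node ts) e = e
  swap-children (bin _ _) (bin _ _) (node ts) (i , j , i≢j , el , er) =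
    j , i , (λ j≡i → i≢j (sym j≡i)) , er , el

  two-slots : ∀ l r (ma mb : Maybe Tree) → TopMinor l ma → TopMinor r mb →
              Emb (bin l r) (node (opt ma ++ opt mb))
  two-slots nil       nil       ma       mb       _  _  = tt
  two-slots (bin _ _) nil       (just _) mb       el _  = zero , el
  two-slots nil       (bin _ _) nothing  (just _) _  er = zero , er
  two-slots nil       (bin _ _) (just _) (just _) _  er = suc zero , er
  two-slots (bin _ _) (bin _ _) (just _) (just _) el er = zero , suc zero , (λ ()) , el , er

  place : ∀ {T a b} (ma mb : Maybe Tree) → Children T a b → TopMinor a ma → TopMinor b mb →
          TopMinor T (just (node (opt ma ++ opt mb)))
  place {a = a} {b} ma mb as-is   ta tb = _ , here , two-slots a b ma mb ta tb
  place {a = a} {b} ma mb swapped ta tb = _ , here , swap-children a b _ (two-slots a b ma mb ta tb)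

  under-last : ∀ T ma s → TopMinor T (just s) → TopMinor T (just (node (opt ma ++ [ s ])))
  under-last nil       _        _ _            = tt
  under-last (bin _ _) nothing  _ (s′ , p , e) = s′ , there zero p , e
  under-last (bin _ _) (just _) _ (s′ , p , e) = s′ , there (suc zero) p , e

  light-≤-half : ∀ {a b m} → a ≤ b → b + a ≤ m → a ≤ m / 2
  light-≤-half {a} {b} {m} a≤b b+a≤m = subst (_≤ m / 2) (m*n/n≡m a 2) (/-monoˡ-≤ 2 a*2≤m)
    where
    a*2≤m : a * 2 ≤ m
    a*2≤m = subst (_≤ m) (trans (cong (a +_) (sym (+-identityʳ a))) (*-comm 2 a))
              (≤-trans (+-monoˡ-≤ a a≤b) b+a≤m)

  Universal : ℕ → Set
  Universal f = ∀ k → k < f → ∀ T → size T ≤ k → TopMinor T (BFuel f k)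

  module Spine (f m : ℕ) (m<f : m < f) (ih : Universal f) where

    n : ℕ
    n = suc m

    -- The end of a heavy path fits at the last spine node u_{k+1}: the
    -- heavy child into B_{⌊αn⌋}, the light child into B_{⌊(n-1)/2⌋}.
    spine-end : ∀ {T h l} → Children T h l → size l ≤ size h → size h ≤ fl n → size T ≤ n →
                ∀ xs → TopMinor T (just (spine f n xs))
    spine-end {T} {h} {l} ch l≤h h≤d T≤n [] =
      place (BFuel f (fl n)) (BFuel f (m / 2)) ch
        (ih (fl n) (≤-trans (fl-< n (s≤s z≤n)) m<f) h h≤d)
        (ih (m / 2) (≤-<-trans (m/n≤m m 2) m<f) l (light-≤-half l≤h h+l≤m))
      where
      h+l≤m : size h + size l ≤ m
      h+l≤m = ≤-pred (subst (_≤ n) (children-size ch) T≤n)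
    spine-end {T} ch l≤h h≤d T≤n (x ∷ xs) = under-last T _ _ (spine-end ch l≤h h≤d T≤n xs)

    -- Along the spine, each light child is served by a larger entry x of
    -- the sequence and goes into B_{x-1}; the heavy child continues below.
    along : ∀ {T cs xs} → HeavyPath (fl n) T cs → Sublist _<_ cs xs → All (_≤ f) xs → size T ≤ n →
            TopMinor T (just (spine f n xs))
    along {xs = xs} (stop ch l≤h h≤d) _ _ T≤n = spine-end ch l≤h h≤d T≤n xs
    along {T} path (_ ∷ʳ served) (_ ∷ bounded) T≤n = under-last T _ _ (along path served bounded T≤n)
    along {xs = suc x ∷ xs} (step {l = l} ch _ _ path) (s≤s l≤x ∷ served) (x<f ∷ bounded) T≤n =
      place (BFuel f x) (just (spine f n xs)) (flip ch)
        (ih x x<f l l≤x)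
        (along path served bounded (≤-trans (child-≤ ch) T≤n))

  universal : ∀ f → Universal f
  universal f       k             _         nil                 _  = tt
  universal (suc f) zero          _         (bin _ _)           ()
  universal (suc f) (suc zero)    _         (bin nil nil)       _  = node [] , here , tt
  universal (suc f) (suc zero)    _         (bin (bin _ _) _)   (s≤s ())
  universal (suc f) (suc zero)    _         (bin nil (bin _ _)) (s≤s ())
  universal (suc f) (suc (suc m)) (s≤s n≤f) (bin l r)           T≤n
    with heavy-path (fl (suc (suc m))) l r
  ... | cs , path = along path (a-serves (fc n) (fc n) ≤-refl cs≤fc) entries≤f T≤n
    where
    open Spine f (suc m) n≤f (universal f)
    -- weight cs ≤ |T| - ⌊αn⌋ - 1 ≤ n - ⌊αn⌋ - 1 ≤ ⌊(1-α)n⌋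
    cs≤fc : weight cs ≤ fc n
    cs≤fc = ≤-trans (heavy-path-weight path)
              (≤-trans (∸-monoˡ-≤ (suc (fl n)) T≤n) (m≤n+o⇒m∸n≤o n (suc (fl n)) (floors-cover n)))
    entries≤f : All (_≤ f) (aFuel (fc n) (fc n))
    entries≤f = All.map (λ x≤fc → ≤-trans x≤fc (≤-trans (fc-≤ n) n≤f)) (a-bounded (fc n) (fc n))

open import Data.Nat.Properties using (≤-refl; ≤-reflexive)

lemma2 : (α : ℝ) → Lo α ½ → Up α 1ℚ →
         (fl fc : ℕ → ℕ) → IsFloorMul α fl → IsFloorOneMinusMul α fc →
         (n : ℕ) (T : BTree) → size T ≡ n →
         TopMinor T (Construction.B fl fc n)
lemma2 α ½<α α<1 fl fc fl-spec fc-spec n T |T|≡n =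
  universal (Nat.suc n) n ≤-refl T (≤-reflexive |T|≡n)
  where
  open FloorFacts α ½<α α<1 fl fc fl-spec fc-spec
  open Universality fl fc fl-< fc-≤ floors-cover
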